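{- Let $\mathcal{G}=(L,\vee,\wedge,\odot,\rightarrow,0,1)$ be an involutive right-residuated l-groupoid satisfying $x\odot y=\rceil(y\rightarrow\rceil x)$ for all $x,y\in L$, and let $\Rightarrow$ be its derived implication. Then: (i) $\mathcal{G}$ is integral if and only if $x\Rightarrow 0=x\rightarrow 0$ for all $x\in L$; (ii) $\mathcal{G}$ is commutative if and only if $x\Rightarrow y=x\rightarrow y$ for all $x,y\in L$; (iii) $\odot$ is associative if and only if $(x\odot y)\Rightarrow z=x\Rightarrow(y\Rightarrow z)$ for all $x,y,z\in L$.
   Context: A right-residuated l-groupoid is an algebra $(L,\vee,\wedge,\odot,\rightarrow,0,1)$ of type $(2,2,2,2,0,0)$ such that $(L,\vee,\wedge)$ is a lattice with least element $0$ and greatest element $1$, $1\odot x=x$ for all $x$, and $x\odot y\le z$ iff $x\le y\rightarrow z$ for all $x,y,z$. It is integral if $1\odot x=x\odot 1=x$ for all $x$, and commutative if $x\odot y=y\odot x$ for all $x,y$. Put $\rceil x:=x\rightarrow 0$; the groupoid is involutive if $x\le y$ implies $\rceil y\le\rceil x$ and $\rceil\rceil x=x$ for all $x,y$. The derived implication is $x\Rightarrow y:=\rceil y\rightarrow\rceil x$. -}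

module Defs where

open import Level using (Level; suc)
open import Relation.Binary.PropositionalEquality using (_≡_)
open import Algebra.Lattice.Structures using (IsLattice)
open import Data.Product using (_×_)

record RRLGroupoid (a : Level) : Set (suc a) where
  infixr 5 _⇾_
  infixl 7 _⊙_
  infixr 6 _∨_
  infixr 6 _∧_
  infix 4 _≤_
  field
    L   : Set a
    _∨_ : L → L → L
    _∧_ : L → L → L
    _⊙_ : L → L → L
    _⇾_ : L → L → L
    𝟘   : L
    𝟙   : L
    isLattice : IsLattice _≡_ _∨_ _∧_

  _≤_ : L → L → Set a
  x ≤ y = x ∨ y ≡ y

  field
    𝟘-least    : ∀ x → 𝟘 ≤ x
    𝟙-greatest : ∀ x → x ≤ 𝟙
    𝟙-left     : ∀ x → 𝟙 ⊙ x ≡ x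
    residuation-to   : ∀ x y z → x ⊙ y ≤ z → x ≤ y ⇾ z
    residuation-from : ∀ x y z → x ≤ y ⇾ z → x ⊙ y ≤ z

  ⌉_ : L → L
  ⌉ x = x ⇾ 𝟘

  _⇒_ : L → L → L
  x ⇒ y = (⌉ y) ⇾ (⌉ x)

  Integral : Set a
  Integral = ∀ x → (𝟙 ⊙ x ≡ x) × (x ⊙ 𝟙 ≡ x)

  Commutative : Set a
  Commutative = ∀ x y → x ⊙ y ≡ y ⊙ x

  Involutive : Set a
  Involutive = (∀ x y → x ≤ y → ⌉ y ≤ ⌉ x) × (∀ x → ⌉ (⌉ x) ≡ x)

  ⊙-Associative : Set a
  ⊙-Associative = ∀ x y z → (x ⊙ y) ⊙ z ≡ x ⊙ (y ⊙ z)

module Submission where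

-- Involution makes ⌉ a bijection, and the defining identity for ⊙ turns both
-- implications into negated products: y ⇾ z = ⌉ (⌉ z ⊙ y) and
-- x ⇒ y = ⌉ (x ⊙ ⌉ y). Each equation between implications is therefore, after
-- cancelling ⌉, an equation between products in which one argument ranges
-- over the image of ⌉, i.e. over all of L: x ⊙ 𝟙 = x (since ⌉ 𝟘 = 𝟙),
-- x ⊙ y = y ⊙ x, and (x ⊙ y) ⊙ z = x ⊙ (y ⊙ z) respectively.

open import Defs
open import Level using (Level)
open import Relation.Binary.PropositionalEquality
open import Data.Product using (_×_; _,_; proj₂)
open import Function.Bundles using (_⇔_; mk⇔)
open import Function.Construct.Composition using (_⇔-∘_)
open import Algebra.Lattice.Structures using (IsLattice)

module _ {a : Level} (G : RRLGroupoid a) where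
  open RRLGroupoid G

  ⌉𝟘≡𝟙 : ⌉ 𝟘 ≡ 𝟙
  ⌉𝟘≡𝟙 = begin
    ⌉ 𝟘      ≡⟨ sym 𝟙≤⌉𝟘 ⟩
    𝟙 ∨ ⌉ 𝟘  ≡⟨ ∨-comm 𝟙 (⌉ 𝟘) ⟩
    ⌉ 𝟘 ∨ 𝟙  ≡⟨ 𝟙-greatest (⌉ 𝟘) ⟩
    𝟙        ∎
    where
    open ≡-Reasoning
    open IsLattice isLattice using (∨-comm)
    𝟙≤⌉𝟘 : 𝟙 ≤ ⌉ 𝟘
    𝟙≤⌉𝟘 = residuation-to 𝟙 𝟘 𝟘 (trans (cong (_∨ 𝟘) (𝟙-left 𝟘)) (𝟘-least 𝟘))

  integral⇔⊙-identityʳ : Integral ⇔ (∀ x → x ⊙ 𝟙 ≡ x)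
  integral⇔⊙-identityʳ = mk⇔ (λ I x → proj₂ (I x)) (λ idʳ x → 𝟙-left x , idʳ x)

  module _ (involutive : Involutive) where

    ⌉-involutive : ∀ x → ⌉ (⌉ x) ≡ x
    ⌉-involutive = proj₂ involutive

    ⌉-injective : ∀ {x y} → ⌉ x ≡ ⌉ y → x ≡ y
    ⌉-injective {x} {y} ⌉x≡⌉y =
      trans (sym (⌉-involutive x)) (trans (cong ⌉_ ⌉x≡⌉y) (⌉-involutive y))

    ∀-via-⌉ : {P : L → Set a} → (∀ x → P (⌉ x)) → ∀ x → P x
    ∀-via-⌉ {P} P⌉ x = subst P (⌉-involutive x) (P⌉ (⌉ x))

    module _ (⊙-via-⇾ : ∀ x y → x ⊙ y ≡ ⌉ (y ⇾ ⌉ x)) where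
      open ≡-Reasoning

      ⇾-via-⊙ : ∀ x y → x ⇾ y ≡ ⌉ (⌉ y ⊙ x)
      ⇾-via-⊙ x y = sym (begin
        ⌉ (⌉ y ⊙ x)           ≡⟨ cong ⌉_ (⊙-via-⇾ (⌉ y) x) ⟩
        ⌉ (⌉ (x ⇾ ⌉ (⌉ y)))   ≡⟨ ⌉-involutive _ ⟩
        x ⇾ ⌉ (⌉ y)           ≡⟨ cong (x ⇾_) (⌉-involutive y) ⟩
        x ⇾ y                 ∎)

      ⇒-via-⊙ : ∀ x y → x ⇒ y ≡ ⌉ (x ⊙ ⌉ y)
      ⇒-via-⊙ x y = begin
        ⌉ y ⇾ ⌉ x             ≡⟨ ⇾-via-⊙ (⌉ y) (⌉ x) ⟩
        ⌉ (⌉ (⌉ x) ⊙ ⌉ y)     ≡⟨ cong (λ w → ⌉ (w ⊙ ⌉ y)) (⌉-involutive x) ⟩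
        ⌉ (x ⊙ ⌉ y)           ∎

      ⊙-identityʳ⇔⇒𝟘≡⇾𝟘 : (∀ x → x ⊙ 𝟙 ≡ x) ⇔ (∀ x → x ⇒ 𝟘 ≡ x ⇾ 𝟘)
      ⊙-identityʳ⇔⇒𝟘≡⇾𝟘 = mk⇔
        (λ idʳ x → trans (⇒𝟘 x) (cong ⌉_ (idʳ x)))
        (λ h x → ⌉-injective (trans (sym (⇒𝟘 x)) (h x)))
        where
        ⇒𝟘 : ∀ x → x ⇒ 𝟘 ≡ ⌉ (x ⊙ 𝟙)
        ⇒𝟘 x = trans (⇒-via-⊙ x 𝟘) (cong (λ w → ⌉ (x ⊙ w)) ⌉𝟘≡𝟙)

      commutative⇔⇒≡⇾ : Commutative ⇔ (∀ x y → x ⇒ y ≡ x ⇾ y)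
      commutative⇔⇒≡⇾ = mk⇔
        (λ comm x y → trans (⇒-via-⊙ x y)
                        (trans (cong ⌉_ (comm x (⌉ y))) (sym (⇾-via-⊙ x y))))
        (λ h x → ∀-via-⌉ (λ y → ⌉-injective
                   (trans (sym (⇒-via-⊙ x y)) (trans (h x y) (⇾-via-⊙ x y)))))

      ⊙-assoc⇔⇒-curry : ⊙-Associative ⇔ (∀ x y z → (x ⊙ y) ⇒ z ≡ x ⇒ (y ⇒ z))
      ⊙-assoc⇔⇒-curry = mk⇔
        (λ assoc x y z → trans (⇒-via-⊙ (x ⊙ y) z)
                           (trans (cong ⌉_ (assoc x y (⌉ z))) (sym (⇒⇒-via-⊙ x y z))))
        (λ h x y → ∀-via-⌉ (λ z → ⌉-injective
                     (trans (sym (⇒-via-⊙ (x ⊙ y) z)) (trans (h x y z) (⇒⇒-via-⊙ x y z)))))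
        where
        ⇒⇒-via-⊙ : ∀ x y z → x ⇒ (y ⇒ z) ≡ ⌉ (x ⊙ (y ⊙ ⌉ z))
        ⇒⇒-via-⊙ x y z = begin
          x ⇒ (y ⇒ z)              ≡⟨ ⇒-via-⊙ x (y ⇒ z) ⟩
          ⌉ (x ⊙ ⌉ (y ⇒ z))        ≡⟨ cong (λ w → ⌉ (x ⊙ ⌉ w)) (⇒-via-⊙ y z) ⟩
          ⌉ (x ⊙ ⌉ (⌉ (y ⊙ ⌉ z)))  ≡⟨ cong (λ w → ⌉ (x ⊙ w)) (⌉-involutive _) ⟩
          ⌉ (x ⊙ (y ⊙ ⌉ z))        ∎

theorem2 : ∀ {a : Level} (G : RRLGroupoid a) → let open RRLGroupoid G in
    Involutive →
    (∀ x y → x ⊙ y ≡ ⌉ (y ⇾ ⌉ x)) →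
    (Integral ⇔ (∀ x → x ⇒ 𝟘 ≡ x ⇾ 𝟘))
    × (Commutative ⇔ (∀ x y → x ⇒ y ≡ x ⇾ y))
    × (⊙-Associative ⇔ (∀ x y z → (x ⊙ y) ⇒ z ≡ x ⇒ (y ⇒ z)))
theorem2 G involutive ⊙-via-⇾ =
    ⊙-identityʳ⇔⇒𝟘≡⇾𝟘 G involutive ⊙-via-⇾ ⇔-∘ integral⇔⊙-identityʳ G
  , commutative⇔⇒≡⇾ G involutive ⊙-via-⇾
  , ⊙-assoc⇔⇒-curry G involutive ⊙-via-⇾
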